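{- Let $r\ge0$ be an integer and let $x^ay^bz^c$ (with $a,c\ge0$, $b\in\mathbb{Z}$) be a monomial occurring with nonzero coefficient in $(D^{(2)})^rx\in\mathbb{Q}[x,y,z,1/y]$. Put $\lambda=a-1$ and $\nu=-c$ (so that $b=\frac{ -\lambda+3\nu+r}{2}$). Then (a) $\nu\ge\frac12(\lambda-r)$; (b) $2b+c\ge0$ and $b\ge-\frac{r+1}{4}$.
   Context: $D^{(2)}$ is the derivation of $\mathbb{Q}(x,y,z)$ given by $D^{(2)}f=\frac{x^2-y}{8}f_x+\frac{xy-z}{2}f_y+\frac{3xz-2y^2-z^2/y}{4}f_z$; it maps $\mathbb{Q}[x,y,z,1/y]$ into itself. $(D^{(2)})^r$ is its $r$-fold iterate. -}

module Defs where

open import Data.Nat as ℕ using (ℕ; zero; suc)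
open import Data.Integer as ℤ using (ℤ; +_)
open import Data.Rational as ℚ using (ℚ; 0ℚ; _/_)
open import Data.List using (List; []; _∷_; _++_; concatMap; map)
open import Data.Product using (_×_; _,_)
open import Relation.Nullary using (yes; no)
open import Relation.Nullary.Decidable using (_×-dec_)

record Term : Set where
  constructor term
  field
    coef : ℚ
    ex   : ℕ
    ey   : ℤ
    ez   : ℕ
open Term public

-- An element of Q[x,y,z,1/y], represented as a finite formal sum of terms
-- (terms with equal exponents are added up by 'coeff' below).
LPoly : Set
LPoly = List Term

coeff : LPoly → ℕ → ℤ → ℕ → ℚ
coeff [] a b c = 0ℚ
coeff (term q a' b' c' ∷ p) a b c with (a' ℕ.≟ a) ×-dec (b' ℤ.≟ b) ×-dec (c' ℕ.≟ c)
... | yes _ = q ℚ.+ coeff p a b c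
... | no  _ = coeff p a b c

mulMon : ℚ → ℕ → ℤ → ℕ → Term → Term
mulMon q i j k (term q' a b c) = term (q ℚ.* q') (i ℕ.+ a) (j ℤ.+ b) (k ℕ.+ c)

-- partial derivatives of a single term (as terms; zero coefficient when the exponent is 0)
∂x ∂y ∂z : Term → Term
∂x (term q a b c) = term (q ℚ.* ((+ a) / 1)) (a ℕ.∸ 1) b c
∂y (term q a b c) = term (q ℚ.* (b / 1)) a (b ℤ.- + 1) c
∂z (term q a b c) = term (q ℚ.* ((+ c) / 1)) a b (c ℕ.∸ 1)

-- D^(2) t = (x²-y)/8 t_x + (xy-z)/2 t_y + (3xz - 2y² - z²/y)/4 t_z
Dterm : Term → LPoly
Dterm t =
    mulMon (+ 1 / 8) 2 (+ 0) 0 (∂x t)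
  ∷ mulMon (ℤ.- + 1 / 8) 0 (+ 1) 0 (∂x t)
  ∷ mulMon (+ 1 / 2) 1 (+ 1) 0 (∂y t)
  ∷ mulMon (ℤ.- + 1 / 2) 0 (+ 0) 1 (∂y t)
  ∷ mulMon (+ 3 / 4) 1 (+ 0) 1 (∂z t)
  ∷ mulMon (ℤ.- + 2 / 4) 0 (+ 2) 0 (∂z t)
  ∷ mulMon (ℤ.- + 1 / 4) 0 (ℤ.- + 1) 2 (∂z t)
  ∷ []

D2 : LPoly → LPoly
D2 = concatMap Dterm

D2^ : ℕ → LPoly → LPoly
D2^ zero p = p
D2^ (suc r) p = D2 (D2^ r p)

xPoly : LPoly
xPoly = term (+ 1 / 1) 1 (+ 0) 0 ∷ []

-- D^(2) is a sum of four monomial shifts: it multiplies the monomial x^a y^b z^c by x, y/x,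
-- z/y or y²/z, with coefficients linear in (a, b, c).  Each shift raises the weight
-- a + 2b + 3c by one, so every monomial of (D^(2))^r x has weight r + 1.  The shifts change
-- 2b + c by 0, +2, -1 and +3; the only decreasing one, by z/y, comes from -½ z ∂y - ¼ (z²/y) ∂z
-- and has coefficient -(2b + c)/4, which vanishes exactly when 2b + c is already 0.  Hence
-- 2b + c ≥ 0 throughout, and the bounds (a) and (b) are linear consequences of these two facts.
module Submission where

open import Defs
open import Data.Nat using (ℕ)
open import Data.Integer using (ℤ; +_; _+_; _-_; _*_; -_; _≤_)
open import Data.Rational using (0ℚ)
open import Data.Product using (_×_)
open import Relation.Binary.PropositionalEquality using (_≢_; _≡_)

open import Data.Nat as ℕ using (zero; suc; _∸_)
import Data.Nat.Properties as ℕP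
import Data.Integer as ℤ
import Data.Integer.Properties as ℤP
open import Data.Integer.Tactic.RingSolver using (solve-∀)
open import Data.Rational as ℚ using (ℚ; _/_)
import Data.Rational.Properties as ℚP
open import Data.Rational.Solver using (module +-*-Solver)
import Data.Rational.Unnormalised as ℚᵘ
import Data.Rational.Unnormalised.Properties as ℚᵘP
open import Data.List using (List; []; _∷_; _++_; foldr)
open import Data.List.Relation.Unary.All using (All; []; _∷_)
open import Data.Product using (_,_)
open import Data.Empty using (⊥-elim)
open import Relation.Nullary using (Dec; yes; no; ¬_)
open import Relation.Nullary.Decidable using (map′; _×-dec_; toSum; decidable-stable)
open import Data.Sum using (_⊎_; inj₁; inj₂)
open import Relation.Binary.PropositionalEquality
  using (refl; sym; trans; cong; cong₂; subst; ≢-sym; module ≡-Reasoning)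

Monomial : Set
Monomial = ℕ × ℤ × ℕ

coeffAt : LPoly → Monomial → ℚ
coeffAt p (a , b , c) = coeff p a b c

[_] : Term → LPoly
[ t ] = t ∷ []

Matches : Term → Monomial → Set
Matches (term _ a′ b′ c′) (a , b , c) = a′ ≡ a × b′ ≡ b × c′ ≡ c

coeffAt-∷ : ∀ t p m → coeffAt (t ∷ p) m ≡ coeffAt [ t ] m ℚ.+ coeffAt p m
coeffAt-∷ (term q a′ b′ c′) p (a , b , c) with (a′ ℕ.≟ a) ×-dec (b′ ℤ.≟ b) ×-dec (c′ ℕ.≟ c)
... | yes _ = cong (ℚ._+ coeff p a b c) (sym (ℚP.+-identityʳ q))
... | no  _ = sym (ℚP.+-identityˡ _)

coeffAt-++ : ∀ p p′ m → coeffAt (p ++ p′) m ≡ coeffAt p m ℚ.+ coeffAt p′ m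
coeffAt-++ []      p′ m = sym (ℚP.+-identityˡ _)
coeffAt-++ (t ∷ p) p′ m = begin
  coeffAt (t ∷ p ++ p′) m                               ≡⟨ coeffAt-∷ t (p ++ p′) m ⟩
  coeffAt [ t ] m ℚ.+ coeffAt (p ++ p′) m               ≡⟨ cong (coeffAt [ t ] m ℚ.+_) (coeffAt-++ p p′ m) ⟩
  coeffAt [ t ] m ℚ.+ (coeffAt p m ℚ.+ coeffAt p′ m)    ≡⟨ ℚP.+-assoc (coeffAt [ t ] m) (coeffAt p m) (coeffAt p′ m) ⟨
  (coeffAt [ t ] m ℚ.+ coeffAt p m) ℚ.+ coeffAt p′ m    ≡⟨ cong (ℚ._+ coeffAt p′ m) (coeffAt-∷ t p m) ⟨
  coeffAt (t ∷ p) m ℚ.+ coeffAt p′ m                    ∎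
  where open ≡-Reasoning

coeffAt-as-sum : ∀ p m → coeffAt p m ≡ foldr (λ t s → coeffAt [ t ] m ℚ.+ s) 0ℚ p
coeffAt-as-sum []      m = refl
coeffAt-as-sum (t ∷ p) m = trans (coeffAt-∷ t p m) (cong (coeffAt [ t ] m ℚ.+_) (coeffAt-as-sum p m))

matches? : ∀ t m → Dec (Matches t m)
matches? (term _ a′ b′ c′) (a , b , c) = (a′ ℕ.≟ a) ×-dec (b′ ℤ.≟ b) ×-dec (c′ ℕ.≟ c)

coeffAt-[]-match : ∀ t m → Matches t m → coeffAt [ t ] m ≡ coef t
coeffAt-[]-match t@(term q _ _ _) m@(_ , _ , _) match with matches? t m
... | yes _      = ℚP.+-identityʳ q
... | no ¬match = ⊥-elim (¬match match)

coeffAt-[]-mismatch : ∀ t m → ¬ Matches t m → coeffAt [ t ] m ≡ 0ℚ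
coeffAt-[]-mismatch t@(term _ _ _ _) m@(_ , _ , _) ¬match with matches? t m
... | yes match = ⊥-elim (¬match match)
... | no  _     = refl

coeffAt-[]-vanish : ∀ t m → (Matches t m → coef t ≡ 0ℚ) → coeffAt [ t ] m ≡ 0ℚ
coeffAt-[]-vanish t m coef≡0 with toSum (matches? t m)
... | inj₁ match  = trans (coeffAt-[]-match t m match) (coef≡0 match)
... | inj₂ ¬match = coeffAt-[]-mismatch t m ¬match

*-coeffAt-[]-vanish : ∀ w t m → (Matches t m → w ≡ 0ℚ) → w ℚ.* coeffAt [ t ] m ≡ 0ℚ
*-coeffAt-[]-vanish w t m w≡0 with toSum (matches? t m)
... | inj₁ match  = trans (cong (ℚ._* coeffAt [ t ] m) (w≡0 match)) (ℚP.*-zeroˡ (coeffAt [ t ] m))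
... | inj₂ ¬match = trans (cong (w ℚ.*_) (coeffAt-[]-mismatch t m ¬match)) (ℚP.*-zeroʳ w)

coeffAt-[]-scale : ∀ t t′ m m′ w →
  (Matches t m → Matches t′ m′) → (Matches t′ m′ → Matches t m) →
  (Matches t′ m′ → coef t ≡ w ℚ.* coef t′) →
  coeffAt [ t ] m ≡ w ℚ.* coeffAt [ t′ ] m′
coeffAt-[]-scale t t′ m m′ w to from scale with toSum (matches? t′ m′)
... | inj₁ match′ = begin
  coeffAt [ t ] m          ≡⟨ coeffAt-[]-match t m (from match′) ⟩
  coef t                   ≡⟨ scale match′ ⟩
  w ℚ.* coef t′            ≡⟨ cong (w ℚ.*_) (coeffAt-[]-match t′ m′ match′) ⟨
  w ℚ.* coeffAt [ t′ ] m′  ∎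
  where open ≡-Reasoning
... | inj₂ ¬match′ = begin
  coeffAt [ t ] m          ≡⟨ coeffAt-[]-mismatch t m (λ match → ¬match′ (to match)) ⟩
  0ℚ                       ≡⟨ ℚP.*-zeroʳ w ⟨
  w ℚ.* 0ℚ                 ≡⟨ cong (w ℚ.*_) (coeffAt-[]-mismatch t′ m′ ¬match′) ⟨
  w ℚ.* coeffAt [ t′ ] m′  ∎
  where open ≡-Reasoning

coeffAt-[]-both-vanish : ∀ t t′ m m′ w →
  (Matches t m → coef t ≡ 0ℚ) → (Matches t′ m′ → w ≡ 0ℚ) →
  coeffAt [ t ] m ≡ w ℚ.* coeffAt [ t′ ] m′
coeffAt-[]-both-vanish t t′ m m′ w coef≡0 w≡0 =
  trans (coeffAt-[]-vanish t m coef≡0) (sym (*-coeffAt-[]-vanish w t′ m′ w≡0))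

rescale : ∀ k q {x y : ℤ} → x ≡ y → k ℚ.* (q ℚ.* (x / 1)) ≡ (k ℚ.* (y / 1)) ℚ.* q
rescale k q {x} refl = trans (cong (k ℚ.*_) (ℚP.*-comm q (x / 1))) (sym (ℚP.*-assoc k (x / 1) q))

rescale-by-0 : ∀ k q → k ℚ.* (q ℚ.* 0ℚ) ≡ 0ℚ
rescale-by-0 k q = trans (cong (k ℚ.*_) (ℚP.*-zeroʳ q)) (ℚP.*-zeroʳ k)

suc≡∸1⇒suc²≡ : ∀ {k} a → suc k ≡ a ∸ 1 → suc (suc k) ≡ a
suc≡∸1⇒suc²≡ (suc a) e = cong suc e

i+j≡k⇒j≡k-i : ∀ δ {x y} → δ + x ≡ y → x ≡ y - δ
i+j≡k⇒j≡k-i δ {x} refl = j≡[i+j]-i δ x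
  where
  j≡[i+j]-i : ∀ d x → x ≡ (d + x) - d
  j≡[i+j]-i = solve-∀

j≡k-i⇒i+j≡k : ∀ δ {x y} → x ≡ y - δ → δ + x ≡ y
j≡k-i⇒i+j≡k δ {y = y} refl = i+[k-i]≡k δ y
  where
  i+[k-i]≡k : ∀ d y → d + (y - d) ≡ y
  i+[k-i]≡k = solve-∀

x²∂x y∂x xy∂y z∂y xz∂z y²∂z z²/y∂z : Term → Term
x²∂x   t = mulMon (+ 1 / 8)   2 (+ 0)   0 (∂x t)
y∂x    t = mulMon (- + 1 / 8) 0 (+ 1)   0 (∂x t)
xy∂y   t = mulMon (+ 1 / 2)   1 (+ 1)   0 (∂y t)
z∂y    t = mulMon (- + 1 / 2) 0 (+ 0)   1 (∂y t)
xz∂z   t = mulMon (+ 3 / 4)   1 (+ 0)   1 (∂z t)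
y²∂z   t = mulMon (- + 2 / 4) 0 (+ 2)   0 (∂z t)
z²/y∂z t = mulMon (- + 1 / 4) 0 (- + 1) 2 (∂z t)

w-x²∂x w-y∂x w-xy∂y w-z∂y w-xz∂z w-y²∂z w-z²/y∂z : Monomial → ℚ
w-x²∂x   (a , b , c)     = + 1 / 8 ℚ.* (+ (a ∸ 1) / 1)
w-y∂x    (a , b , c)     = - + 1 / 8 ℚ.* (+ suc a / 1)
w-xy∂y   (zero , b , c)  = 0ℚ
w-xy∂y   (suc a , b , c) = + 1 / 2 ℚ.* (b / 1)
w-z∂y    (a , b , zero)  = 0ℚ
w-z∂y    (a , b , suc c) = - + 1 / 2 ℚ.* ((b + + 1) / 1)
w-xz∂z   (zero , b , c)  = 0ℚ
w-xz∂z   (suc a , b , c) = + 3 / 4 ℚ.* (+ c / 1)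
w-y²∂z   (a , b , c)     = - + 2 / 4 ℚ.* (+ suc c / 1)
w-z²/y∂z (a , b , zero)  = 0ℚ
w-z²/y∂z (a , b , suc c) = - + 1 / 4 ℚ.* (+ c / 1)

coeffAt-x²∂x : ∀ t a b c → coeffAt [ x²∂x t ] (a , b , c) ≡ w-x²∂x (a , b , c) ℚ.* coeffAt [ t ] (a ∸ 1 , b , c)
coeffAt-x²∂x t@(term q zero b′ c′) a b c =
  coeffAt-[]-both-vanish (x²∂x t) t (a , b , c) (a ∸ 1 , b , c) (w-x²∂x (a , b , c))
    (λ _ → rescale-by-0 (+ 1 / 8) q)
    (λ (e₁ , _) → cong (λ n → + 1 / 8 ℚ.* (+ n / 1)) (sym e₁))
coeffAt-x²∂x t@(term q (suc k) b′ c′) a b c =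
  coeffAt-[]-scale (x²∂x t) t (a , b , c) (a ∸ 1 , b , c) (w-x²∂x (a , b , c))
    (λ (e₁ , e₂ , e₃) → cong (_∸ 1) e₁ , trans (sym (ℤP.+-identityˡ b′)) e₂ , e₃)
    (λ (e₁ , e₂ , e₃) → suc≡∸1⇒suc²≡ a e₁ , trans (ℤP.+-identityˡ b′) e₂ , e₃)
    (λ (e₁ , _) → rescale (+ 1 / 8) q (cong +_ e₁))

coeffAt-y∂x : ∀ t a b c → coeffAt [ y∂x t ] (a , b , c) ≡ w-y∂x (a , b , c) ℚ.* coeffAt [ t ] (suc a , b - + 1 , c)
coeffAt-y∂x t@(term q zero b′ c′) a b c =
  coeffAt-[]-both-vanish (y∂x t) t (a , b , c) (suc a , b - + 1 , c) (w-y∂x (a , b , c))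
    (λ _ → rescale-by-0 (- + 1 / 8) q)
    (λ { (() , _) })
coeffAt-y∂x t@(term q (suc k) b′ c′) a b c =
  coeffAt-[]-scale (y∂x t) t (a , b , c) (suc a , b - + 1 , c) (w-y∂x (a , b , c))
    (λ (e₁ , e₂ , e₃) → cong suc e₁ , i+j≡k⇒j≡k-i (+ 1) e₂ , e₃)
    (λ (e₁ , e₂ , e₃) → ℕP.suc-injective e₁ , j≡k-i⇒i+j≡k (+ 1) e₂ , e₃)
    (λ (e₁ , _) → rescale (- + 1 / 8) q (cong +_ e₁))

coeffAt-xy∂y : ∀ t a b c → coeffAt [ xy∂y t ] (a , b , c) ≡ w-xy∂y (a , b , c) ℚ.* coeffAt [ t ] (a ∸ 1 , b , c)
coeffAt-xy∂y t@(term q a′ b′ c′) zero b c =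
  coeffAt-[]-both-vanish (xy∂y t) t (zero , b , c) (zero , b , c) 0ℚ (λ { (() , _) }) (λ _ → refl)
coeffAt-xy∂y t@(term q a′ b′ c′) (suc a) b c =
  coeffAt-[]-scale (xy∂y t) t (suc a , b , c) (a , b , c) (w-xy∂y (suc a , b , c))
    (λ (e₁ , e₂ , e₃) → ℕP.suc-injective e₁ , trans (sym (1+[x-1]≡x b′)) e₂ , e₃)
    (λ (e₁ , e₂ , e₃) → cong suc e₁ , trans (1+[x-1]≡x b′) e₂ , e₃)
    (λ (_ , e₂ , _) → rescale (+ 1 / 2) q e₂)
  where
  1+[x-1]≡x : ∀ x → + 1 + (x - + 1) ≡ x
  1+[x-1]≡x = solve-∀

coeffAt-z∂y : ∀ t a b c → coeffAt [ z∂y t ] (a , b , c) ≡ w-z∂y (a , b , c) ℚ.* coeffAt [ t ] (a , b + + 1 , c ∸ 1)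
coeffAt-z∂y t@(term q a′ b′ c′) a b zero =
  coeffAt-[]-both-vanish (z∂y t) t (a , b , zero) (a , b + + 1 , zero) 0ℚ (λ { (_ , _ , ()) }) (λ _ → refl)
coeffAt-z∂y t@(term q a′ b′ c′) a b (suc c) =
  coeffAt-[]-scale (z∂y t) t (a , b , suc c) (a , b + + 1 , c) (w-z∂y (a , b , suc c))
    (λ (e₁ , e₂ , e₃) → e₁ , trans (x≡0+[x-1]+1 b′) (cong (_+ + 1) e₂) , ℕP.suc-injective e₃)
    (λ (e₁ , e₂ , e₃) → e₁ , trans (cong (λ x → + 0 + (x - + 1)) e₂) (0+[[y+1]-1]≡y b) , cong suc e₃)
    (λ (_ , e₂ , _) → rescale (- + 1 / 2) q e₂)
  where
  x≡0+[x-1]+1 : ∀ x → x ≡ (+ 0 + (x - + 1)) + + 1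
  x≡0+[x-1]+1 = solve-∀
  0+[[y+1]-1]≡y : ∀ y → + 0 + ((y + + 1) - + 1) ≡ y
  0+[[y+1]-1]≡y = solve-∀

coeffAt-xz∂z : ∀ t a b c → coeffAt [ xz∂z t ] (a , b , c) ≡ w-xz∂z (a , b , c) ℚ.* coeffAt [ t ] (a ∸ 1 , b , c)
coeffAt-xz∂z t@(term q a′ b′ c′) zero b c =
  coeffAt-[]-both-vanish (xz∂z t) t (zero , b , c) (zero , b , c) 0ℚ (λ { (() , _) }) (λ _ → refl)
coeffAt-xz∂z t@(term q a′ b′ zero) (suc a) b c =
  coeffAt-[]-both-vanish (xz∂z t) t (suc a , b , c) (a , b , c) (w-xz∂z (suc a , b , c))
    (λ _ → rescale-by-0 (+ 3 / 4) q)
    (λ (_ , _ , e₃) → cong (λ n → + 3 / 4 ℚ.* (+ n / 1)) (sym e₃))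
coeffAt-xz∂z t@(term q a′ b′ (suc k)) (suc a) b c =
  coeffAt-[]-scale (xz∂z t) t (suc a , b , c) (a , b , c) (w-xz∂z (suc a , b , c))
    (λ (e₁ , e₂ , e₃) → ℕP.suc-injective e₁ , trans (sym (ℤP.+-identityˡ b′)) e₂ , e₃)
    (λ (e₁ , e₂ , e₃) → cong suc e₁ , trans (ℤP.+-identityˡ b′) e₂ , e₃)
    (λ (_ , _ , e₃) → rescale (+ 3 / 4) q (cong +_ e₃))

coeffAt-y²∂z : ∀ t a b c → coeffAt [ y²∂z t ] (a , b , c) ≡ w-y²∂z (a , b , c) ℚ.* coeffAt [ t ] (a , b - + 2 , suc c)
coeffAt-y²∂z t@(term q a′ b′ zero) a b c =
  coeffAt-[]-both-vanish (y²∂z t) t (a , b , c) (a , b - + 2 , suc c) (w-y²∂z (a , b , c))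
    (λ _ → rescale-by-0 (- + 2 / 4) q)
    (λ { (_ , _ , ()) })
coeffAt-y²∂z t@(term q a′ b′ (suc k)) a b c =
  coeffAt-[]-scale (y²∂z t) t (a , b , c) (a , b - + 2 , suc c) (w-y²∂z (a , b , c))
    (λ (e₁ , e₂ , e₃) → e₁ , i+j≡k⇒j≡k-i (+ 2) e₂ , cong suc e₃)
    (λ (e₁ , e₂ , e₃) → e₁ , j≡k-i⇒i+j≡k (+ 2) e₂ , ℕP.suc-injective e₃)
    (λ (_ , _ , e₃) → rescale (- + 2 / 4) q (cong +_ e₃))

coeffAt-z²/y∂z : ∀ t a b c → coeffAt [ z²/y∂z t ] (a , b , c) ≡ w-z²/y∂z (a , b , c) ℚ.* coeffAt [ t ] (a , b + + 1 , c ∸ 1)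
coeffAt-z²/y∂z t@(term q a′ b′ c′) a b zero =
  coeffAt-[]-both-vanish (z²/y∂z t) t (a , b , zero) (a , b + + 1 , zero) 0ℚ (λ { (_ , _ , ()) }) (λ _ → refl)
coeffAt-z²/y∂z t@(term q a′ b′ zero) a b (suc c) =
  coeffAt-[]-both-vanish (z²/y∂z t) t (a , b , suc c) (a , b + + 1 , c) (w-z²/y∂z (a , b , suc c))
    (λ _ → rescale-by-0 (- + 1 / 4) q)
    (λ (_ , _ , e₃) → cong (λ n → - + 1 / 4 ℚ.* (+ n / 1)) (sym e₃))
coeffAt-z²/y∂z t@(term q a′ b′ (suc k)) a b (suc c) =
  coeffAt-[]-scale (z²/y∂z t) t (a , b , suc c) (a , b + + 1 , c) (w-z²/y∂z (a , b , suc c))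
    (λ (e₁ , e₂ , e₃) → e₁ , i+j≡k⇒j≡k-i (- + 1) e₂ , ℕP.suc-injective e₃)
    (λ (e₁ , e₂ , e₃) → e₁ , j≡k-i⇒i+j≡k (- + 1) e₂ , cong suc e₃)
    (λ (_ , _ , e₃) → rescale (- + 1 / 4) q (cong +_ e₃))

weightedSum : {A : Set} → List (ℚ × A) → (A → ℚ) → ℚ
weightedSum []             f = 0ℚ
weightedSum ((w , n) ∷ ws) f = w ℚ.* f n ℚ.+ weightedSum ws f

weightedSum-cong : {A : Set} (ws : List (ℚ × A)) {f g : A → ℚ} → (∀ n → f n ≡ g n) → weightedSum ws f ≡ weightedSum ws g
weightedSum-cong []             f≗g = refl
weightedSum-cong ((w , n) ∷ ws) f≗g = cong₂ ℚ._+_ (cong (w ℚ.*_) (f≗g n)) (weightedSum-cong ws f≗g)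

weightedSum-+ : {A : Set} (ws : List (ℚ × A)) (f g : A → ℚ) →
  weightedSum ws (λ n → f n ℚ.+ g n) ≡ weightedSum ws f ℚ.+ weightedSum ws g
weightedSum-+ []             f g = refl
weightedSum-+ ((w , n) ∷ ws) f g =
  trans (cong (w ℚ.* (f n ℚ.+ g n) ℚ.+_) (weightedSum-+ ws f g))
        (distribute w (f n) (g n) (weightedSum ws f) (weightedSum ws g))
  where
  distribute : ∀ w x y s t → w ℚ.* (x ℚ.+ y) ℚ.+ (s ℚ.+ t) ≡ (w ℚ.* x ℚ.+ s) ℚ.+ (w ℚ.* y ℚ.+ t)
  distribute = +-*-Solver.solve 5 (λ w x y s t → w :* (x :+ y) :+ (s :+ t) := (w :* x :+ s) :+ (w :* y :+ t)) refl
    where open +-*-Solver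

weightedSum-vanish : {A : Set} (ws : List (ℚ × A)) (f : A → ℚ) →
  All (λ { (w , n) → w ≡ 0ℚ ⊎ f n ≡ 0ℚ }) ws → weightedSum ws f ≡ 0ℚ
weightedSum-vanish []             f []       = refl
weightedSum-vanish ((w , n) ∷ ws) f (v ∷ vs) = cong₂ ℚ._+_ (term-vanishes v) (weightedSum-vanish ws f vs)
  where
  term-vanishes : w ≡ 0ℚ ⊎ f n ≡ 0ℚ → w ℚ.* f n ≡ 0ℚ
  term-vanishes (inj₁ refl) = ℚP.*-zeroˡ (f n)
  term-vanishes (inj₂ f≡0)  = trans (cong (w ℚ.*_) f≡0) (ℚP.*-zeroʳ w)

-- The weights vanish at a = 0 and c = 0 respectively, so the truncated a ∸ 1 and c ∸ 1 are harmless.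
contributions : Monomial → List (ℚ × Monomial)
contributions m@(a , b , c) =
    (w-x²∂x m ℚ.+ w-xy∂y m ℚ.+ w-xz∂z m , (a ∸ 1 , b , c))
  ∷ (w-y∂x m , (suc a , b - + 1 , c))
  ∷ (w-z∂y m ℚ.+ w-z²/y∂z m , (a , b + + 1 , c ∸ 1))
  ∷ (w-y²∂z m , (a , b - + 2 , suc c))
  ∷ []

coeffAt-Dterm : ∀ t m → coeffAt (Dterm t) m ≡ weightedSum (contributions m) (coeffAt [ t ])
coeffAt-Dterm t m@(a , b , c) = begin
  coeffAt (Dterm t) m
    ≡⟨ coeffAt-as-sum (Dterm t) m ⟩
  coeffAt [ x²∂x t ] m ℚ.+ (coeffAt [ y∂x t ] m ℚ.+ (coeffAt [ xy∂y t ] m ℚ.+ (coeffAt [ z∂y t ] m ℚ.+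
    (coeffAt [ xz∂z t ] m ℚ.+ (coeffAt [ y²∂z t ] m ℚ.+ (coeffAt [ z²/y∂z t ] m ℚ.+ 0ℚ))))))
    ≡⟨ cong₂ ℚ._+_ (coeffAt-x²∂x t a b c) (cong₂ ℚ._+_ (coeffAt-y∂x t a b c) (cong₂ ℚ._+_ (coeffAt-xy∂y t a b c)
         (cong₂ ℚ._+_ (coeffAt-z∂y t a b c) (cong₂ ℚ._+_ (coeffAt-xz∂z t a b c) (cong₂ ℚ._+_ (coeffAt-y²∂z t a b c)
         (cong (ℚ._+ 0ℚ) (coeffAt-z²/y∂z t a b c))))))) ⟩
  w₁ ℚ.* X ℚ.+ (w₂ ℚ.* Y ℚ.+ (w₃ ℚ.* X ℚ.+ (w₄ ℚ.* Z ℚ.+ (w₅ ℚ.* X ℚ.+ (w₆ ℚ.* U ℚ.+ (w₇ ℚ.* Z ℚ.+ 0ℚ))))))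
    ≡⟨ regroup w₁ w₂ w₃ w₄ w₅ w₆ w₇ X Y Z U ⟩
  weightedSum (contributions m) (coeffAt [ t ]) ∎
  where
  open ≡-Reasoning
  w₁ = w-x²∂x m; w₂ = w-y∂x m; w₃ = w-xy∂y m; w₄ = w-z∂y m; w₅ = w-xz∂z m; w₆ = w-y²∂z m; w₇ = w-z²/y∂z m
  X = coeffAt [ t ] (a ∸ 1 , b , c)
  Y = coeffAt [ t ] (suc a , b - + 1 , c)
  Z = coeffAt [ t ] (a , b + + 1 , c ∸ 1)
  U = coeffAt [ t ] (a , b - + 2 , suc c)
  regroup : ∀ w₁ w₂ w₃ w₄ w₅ w₆ w₇ X Y Z U →
    w₁ ℚ.* X ℚ.+ (w₂ ℚ.* Y ℚ.+ (w₃ ℚ.* X ℚ.+ (w₄ ℚ.* Z ℚ.+ (w₅ ℚ.* X ℚ.+ (w₆ ℚ.* U ℚ.+ (w₇ ℚ.* Z ℚ.+ 0ℚ))))))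
    ≡ (w₁ ℚ.+ w₃ ℚ.+ w₅) ℚ.* X ℚ.+ (w₂ ℚ.* Y ℚ.+ ((w₄ ℚ.+ w₇) ℚ.* Z ℚ.+ (w₆ ℚ.* U ℚ.+ 0ℚ)))
  regroup = +-*-Solver.solve 11
    (λ w₁ w₂ w₃ w₄ w₅ w₆ w₇ X Y Z U →
      w₁ :* X :+ (w₂ :* Y :+ (w₃ :* X :+ (w₄ :* Z :+ (w₅ :* X :+ (w₆ :* U :+ (w₇ :* Z :+ con 0ℚ))))))
      := (w₁ :+ w₃ :+ w₅) :* X :+ (w₂ :* Y :+ ((w₄ :+ w₇) :* Z :+ (w₆ :* U :+ con 0ℚ))))
    refl
    where open +-*-Solver

coeffAt-D2 : ∀ p m → coeffAt (D2 p) m ≡ weightedSum (contributions m) (coeffAt p)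
coeffAt-D2 []      m = sym (weightedSum-vanish (contributions m) (coeffAt []) (inj₂ refl ∷ inj₂ refl ∷ inj₂ refl ∷ inj₂ refl ∷ []))
coeffAt-D2 (t ∷ p) m = begin
  coeffAt (Dterm t ++ D2 p) m                                 ≡⟨ coeffAt-++ (Dterm t) (D2 p) m ⟩
  coeffAt (Dterm t) m ℚ.+ coeffAt (D2 p) m                    ≡⟨ cong₂ ℚ._+_ (coeffAt-Dterm t m) (coeffAt-D2 p m) ⟩
  weightedSum ws (coeffAt [ t ]) ℚ.+ weightedSum ws (coeffAt p) ≡⟨ weightedSum-+ ws (coeffAt [ t ]) (coeffAt p) ⟨
  weightedSum ws (λ n → coeffAt [ t ] n ℚ.+ coeffAt p n)      ≡⟨ weightedSum-cong ws (λ n → sym (coeffAt-∷ t p n)) ⟩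
  weightedSum ws (coeffAt (t ∷ p))                            ∎
  where
  open ≡-Reasoning
  ws = contributions m

toℚᵘ-*-/1 : ∀ k v → ℚ.toℚᵘ (k ℚ.* (v / 1)) ℚᵘ.≃ ℚ.toℚᵘ k ℚᵘ.* ℚᵘ.mkℚᵘ v 0
toℚᵘ-*-/1 k v = ℚᵘP.≃-trans (ℚP.toℚᵘ-homo-* k (v / 1)) (ℚᵘP.*-congˡ {ℚ.toℚᵘ k} (ℚP.toℚᵘ-fromℚᵘ (ℚᵘ.mkℚᵘ v 0)))

z/y-weight-vanishes : ∀ v u → + 2 * v + u ≡ + 0 → - + 1 / 2 ℚ.* (v / 1) ℚ.+ - + 1 / 4 ℚ.* (u / 1) ≡ 0ℚ
z/y-weight-vanishes v u 2v+u≡0 = ℚP.toℚᵘ-injective (begin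
  ℚ.toℚᵘ (- + 1 / 2 ℚ.* (v / 1) ℚ.+ - + 1 / 4 ℚ.* (u / 1))
    ≈⟨ ℚP.toℚᵘ-homo-+ (- + 1 / 2 ℚ.* (v / 1)) (- + 1 / 4 ℚ.* (u / 1)) ⟩
  ℚ.toℚᵘ (- + 1 / 2 ℚ.* (v / 1)) ℚᵘ.+ ℚ.toℚᵘ (- + 1 / 4 ℚ.* (u / 1))
    ≈⟨ ℚᵘP.+-cong (toℚᵘ-*-/1 (- + 1 / 2) v) (toℚᵘ-*-/1 (- + 1 / 4) u) ⟩
  ℚᵘ.mkℚᵘ (- + 1) 1 ℚᵘ.* ℚᵘ.mkℚᵘ v 0 ℚᵘ.+ ℚᵘ.mkℚᵘ (- + 1) 3 ℚᵘ.* ℚᵘ.mkℚᵘ u 0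
    ≈⟨ ℚᵘ.*≡* (trans (cross-multiplied v u) (cong (_* - + 2) 2v+u≡0)) ⟩
  ℚᵘ.0ℚᵘ ∎)
  where
  open ℚᵘP.≃-Reasoning
  cross-multiplied : ∀ v u → ((- + 1 * v) * + 4 + (- + 1 * u) * + 2) * + 1 ≡ (+ 2 * v + u) * - + 2
  cross-multiplied = solve-∀

weight yz-degree : Monomial → ℤ
weight    (a , b , c) = + a + + 2 * b + + 3 * + c
yz-degree (a , b , c) = + 2 * b + + c

record Admissible (r : ℕ) (m : Monomial) : Set where
  constructor admissible
  field
    weight≡     : weight m ≡ + suc r
    yz-degree≥0 : + 0 ≤ yz-degree m

admissible? : ∀ r m → Dec (Admissible r m)
admissible? r m = map′ (λ (w , d) → admissible w d) (λ (admissible w d) → w , d)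
  ((weight m ℤ.≟ + suc r) ×-dec (+ 0 ℤ.≤? yz-degree m))

admissible-x· : ∀ {r a b c} → Admissible r (a , b , c) → Admissible (suc r) (suc a , b , c)
admissible-x· {a = a} {b} {c} (admissible weight nonneg) =
  admissible (trans (weight-step (+ a) b (+ c)) (cong ℤ.suc weight)) nonneg
  where
  weight-step : ∀ A B C → + 1 + A + + 2 * B + + 3 * C ≡ + 1 + (A + + 2 * B + + 3 * C)
  weight-step = solve-∀

admissible-y/x· : ∀ {r a b c} → Admissible r (suc a , b - + 1 , c) → Admissible (suc r) (a , b , c)
admissible-y/x· {a = a} {b} {c} (admissible weight nonneg) = admissible
  (trans (weight-step (+ a) b (+ c)) (cong ℤ.suc weight))
  (subst (+ 0 ≤_) (sym (yz-degree-step b (+ c))) (ℤP.i≤j⇒i≤k+j (+ 2) nonneg))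
  where
  weight-step : ∀ A B C → A + + 2 * B + + 3 * C ≡ + 1 + ((+ 1 + A) + + 2 * (B - + 1) + + 3 * C)
  weight-step = solve-∀
  yz-degree-step : ∀ B C → + 2 * B + C ≡ + 2 + (+ 2 * (B - + 1) + C)
  yz-degree-step = solve-∀

admissible-z/y· : ∀ {r a b c} → Admissible r (a , b + + 1 , c) → yz-degree (a , b + + 1 , c) ≢ + 0 →
  Admissible (suc r) (a , b , suc c)
admissible-z/y· {a = a} {b} {c} (admissible weight nonneg) ≢0 = admissible
  (trans (weight-step (+ a) b (+ c)) (cong ℤ.suc weight))
  (subst (+ 0 ≤_) (sym (yz-degree-step b (+ c))) (ℤP.i≤j⇒0≤j-i (ℤP.i<j⇒suc[i]≤j (ℤP.≤∧≢⇒< nonneg (≢-sym ≢0)))))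
  where
  weight-step : ∀ A B C → A + + 2 * B + + 3 * (+ 1 + C) ≡ + 1 + (A + + 2 * (B + + 1) + + 3 * C)
  weight-step = solve-∀
  yz-degree-step : ∀ B C → + 2 * B + (+ 1 + C) ≡ (+ 2 * (B + + 1) + C) - + 1
  yz-degree-step = solve-∀

admissible-y²/z· : ∀ {r a b c} → Admissible r (a , b - + 2 , suc c) → Admissible (suc r) (a , b , c)
admissible-y²/z· {a = a} {b} {c} (admissible weight nonneg) = admissible
  (trans (weight-step (+ a) b (+ c)) (cong ℤ.suc weight))
  (subst (+ 0 ≤_) (sym (yz-degree-step b (+ c))) (ℤP.i≤j⇒i≤k+j (+ 3) nonneg))
  where
  weight-step : ∀ A B C → A + + 2 * B + + 3 * C ≡ + 1 + (A + + 2 * (B - + 2) + + 3 * (+ 1 + C))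
  weight-step = solve-∀
  yz-degree-step : ∀ B C → + 2 * B + C ≡ + 3 + (+ 2 * (B - + 2) + (+ 1 + C))
  yz-degree-step = solve-∀

SupportedBy : LPoly → (Monomial → Set) → Set
SupportedBy p P = ∀ m → coeffAt p m ≢ 0ℚ → P m

coeffAt-off-support : ∀ p {P n} → SupportedBy p P → ¬ P n → coeffAt p n ≡ 0ℚ
coeffAt-off-support p {n = n} supported ¬Pn = decidable-stable (coeffAt p n ℚP.≟ 0ℚ) (λ ≢0 → ¬Pn (supported n ≢0))

contributions-vanish : ∀ r p → SupportedBy p (Admissible r) →
  ∀ m → ¬ Admissible (suc r) m → All (λ { (w , n) → w ≡ 0ℚ ⊎ coeffAt p n ≡ 0ℚ }) (contributions m)
contributions-vanish r p supported m@(a , b , c) ¬admissible =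
    via-x a ¬admissible
  ∷ inj₂ (coeffAt-off-support p supported (λ adm → ¬admissible (admissible-y/x· adm)))
  ∷ via-z/y c ¬admissible
  ∷ inj₂ (coeffAt-off-support p supported (λ adm → ¬admissible (admissible-y²/z· adm)))
  ∷ []
  where
  via-x : ∀ a → ¬ Admissible (suc r) (a , b , c) →
    w-x²∂x (a , b , c) ℚ.+ w-xy∂y (a , b , c) ℚ.+ w-xz∂z (a , b , c) ≡ 0ℚ ⊎ coeffAt p (a ∸ 1 , b , c) ≡ 0ℚ
  via-x zero    _   = inj₁ refl
  via-x (suc a) ¬adm = inj₂ (coeffAt-off-support p supported (λ adm → ¬adm (admissible-x· adm)))

  via-z/y : ∀ c → ¬ Admissible (suc r) (a , b , c) →
    w-z∂y (a , b , c) ℚ.+ w-z²/y∂z (a , b , c) ≡ 0ℚ ⊎ coeffAt p (a , b + + 1 , c ∸ 1) ≡ 0ℚ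
  via-z/y zero    _    = inj₁ refl
  via-z/y (suc c) ¬adm with yz-degree (a , b + + 1 , c) ℤ.≟ + 0
  ... | yes ≡0 = inj₁ (z/y-weight-vanishes (b + + 1) (+ c) ≡0)
  ... | no  ≢0 = inj₂ (coeffAt-off-support p supported (λ adm → ¬adm (admissible-z/y· adm ≢0)))

admissible-D2 : ∀ r p → SupportedBy p (Admissible r) → SupportedBy (D2 p) (Admissible (suc r))
admissible-D2 r p supported m ≢0 with admissible? (suc r) m
... | yes adm  = adm
... | no ¬adm = ⊥-elim (≢0 (trans (coeffAt-D2 p m)
                  (weightedSum-vanish (contributions m) (coeffAt p) (contributions-vanish r p supported m ¬adm))))

admissible-x : SupportedBy xPoly (Admissible 0)
admissible-x m@(a , b , c) ≢0 with toSum (matches? (term (+ 1 / 1) 1 (+ 0) 0) m)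
... | inj₁ (refl , refl , refl) = admissible refl (ℤ.+≤+ ℕ.z≤n)
... | inj₂ ¬match = ⊥-elim (≢0 (coeffAt-[]-mismatch (term (+ 1 / 1) 1 (+ 0) 0) m ¬match))

admissible-D2^ : ∀ r → SupportedBy (D2^ r xPoly) (Admissible r)
admissible-D2^ zero    = admissible-x
admissible-D2^ (suc r) = admissible-D2 r (D2^ r xPoly) (admissible-D2^ r)

admissible⇒bounds : ∀ {r a b c} → Admissible r (a , b , c) →
  (+ 2 * b ≡ - (+ a - + 1) + + 3 * (- (+ c)) + + r)
  × ((+ a - + 1) - + r ≤ + 2 * (- (+ c)))
  × (+ 0 ≤ + 2 * b + + c)
  × (- (+ r + + 1) ≤ + 4 * b)
admissible⇒bounds {r} {a} {b} {c} (admissible weight≡ nonneg) =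
    at-r (λ R → + 2 * b ≡ - (+ a - + 1) + + 3 * (- (+ c)) + R) (b-formula (+ a) b (+ c))
  , ℤP.0≤i-j⇒j≤i (at-r (λ R → + 0 ≤ + 2 * (- (+ c)) - ((+ a - + 1) - R))
                       (subst (+ 0 ≤_) (ν-bound-slack (+ a) b (+ c)) nonneg))
  , nonneg
  , ℤP.0≤i-j⇒j≤i (at-r (λ R → + 0 ≤ + 4 * b - (- (R + + 1)))
                       (subst (+ 0 ≤_) (b-bound-slack (+ a) b (+ c)) three-yz-degree+a≥0))
  where
  at-r : (P : ℤ → Set) → P (weight (a , b , c) - + 1) → P (+ r)
  at-r P = subst P (trans (cong (_- + 1) weight≡) ([1+R]-1≡R (+ r)))
    where
    [1+R]-1≡R : ∀ R → (+ 1 + R) - + 1 ≡ R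
    [1+R]-1≡R = solve-∀
  three-yz-degree+a≥0 : + 0 ≤ yz-degree (a , b , c) + (yz-degree (a , b , c) + (yz-degree (a , b , c) + + a))
  three-yz-degree+a≥0 = ℤP.+-mono-≤ nonneg (ℤP.+-mono-≤ nonneg (ℤP.+-mono-≤ nonneg (ℤ.+≤+ ℕ.z≤n)))
  b-formula : ∀ A B C → + 2 * B ≡ - (A - + 1) + + 3 * (- C) + ((A + + 2 * B + + 3 * C) - + 1)
  b-formula = solve-∀
  ν-bound-slack : ∀ A B C → + 2 * B + C ≡ + 2 * (- C) - ((A - + 1) - ((A + + 2 * B + + 3 * C) - + 1))
  ν-bound-slack = solve-∀
  b-bound-slack : ∀ A B C → (+ 2 * B + C) + ((+ 2 * B + C) + ((+ 2 * B + C) + A))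
                     ≡ + 4 * B - (- (((A + + 2 * B + + 3 * C) - + 1) + + 1))
  b-bound-slack = solve-∀

lemma4p1 : (r a : ℕ) (b : ℤ) (c : ℕ) →
    coeff (D2^ r xPoly) a b c ≢ 0ℚ →
    let λ' = + a - + 1
        ν  = - (+ c)
    in (+ 2 * b ≡ - λ' + + 3 * ν + + r)
       × (λ' - + r ≤ + 2 * ν)
       × (+ 0 ≤ + 2 * b + + c)
       × (- (+ r + + 1) ≤ + 4 * b)
lemma4p1 r a b c ≢0 = admissible⇒bounds (admissible-D2^ r (a , b , c) ≢0)
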